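{- Let $n$ be a fixed positive integer. There exist $c_n>0$ and $\eta_n>0$ (depending only on $n$) such that the following holds. Let $\mathcal{A}$ be a finite set and let $\mathcal{B}$ be a nonempty subset of $\{(a_1,\dots,a_n)\in\mathcal{A}^n: a_i=a_j\implies i=j\}$ such that for every $a\in\mathcal{A}$, the proportion of elements of $\mathcal{B}$ having $a$ as a component is at most $\eta_n$. Randomly partition $\mathcal{A}$ into $\mathcal{A}_1$ and $\mathcal{A}_2$, each element of $\mathcal{A}$ being assigned independently to $\mathcal{A}_1$ or $\mathcal{A}_2$ with probability $1/2$ each. Then with probability at least $c_n$, $$|\mathcal{A}_1^n\cap\mathcal{B}|\ge\frac{|\mathcal{B}|}{2^{2n+1}}\quad\text{and}\quad|\mathcal{A}_2^n\cap\mathcal{B}|\ge\frac{|\mathcal{B}|}{2^{2n+1}}.$$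
   Context: $\mathcal{A}_i^n$ denotes the $n$-fold Cartesian product of $\mathcal{A}_i$. The paper phrases the hypothesis as "the proportion of elements of $\mathcal{B}$ with $a$ as a component is $o(1)$" and the conclusion as "a fixed positive lower bound, dependent on $n$ but not on $\mathcal{A}$ or $|\mathcal{A}|$, on the probability"; the statement above is the precise form of this. -}

module Defs where

open import Data.Nat using (ℕ; zero; suc)
open import Data.Bool using (Bool; true; false)
open import Data.Fin using (Fin)
open import Data.Fin.Properties using (_≟_)
open import Data.Vec using (Vec; []; _∷_; lookup)
open import Data.Vec.Membership.Propositional using (_∈_)
import Data.Vec.Membership.DecPropositional as DecMem
open import Data.Vec.Relation.Unary.All as VAll using ()
open import Data.List using (List; []; _∷_; map; _++_; filter; length)
open import Relation.Binary.PropositionalEquality using (_≡_)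
open import Data.Bool.Properties renaming (_≟_ to _≟B_)

-- All 2^m assignments of the ground set Fin m to the two parts
-- (true = part A₁, false = part A₂), each listed exactly once.
allPartitions : (m : ℕ) → List (Vec Bool m)
allPartitions zero = [] ∷ []
allPartitions (suc m) = map (true ∷_) (allPartitions m) ++ map (false ∷_) (allPartitions m)

DistinctTuple : ∀ {m n} → Vec (Fin m) n → Set
DistinctTuple {n = n} b = ∀ (i j : Fin n) → lookup b i ≡ lookup b j → i ≡ j

countContaining : ∀ {m n} → Fin m → List (Vec (Fin m) n) → ℕ
countContaining {m} a B = length (filter (a ∈?_) B)
  where open DecMem (_≟_ {m}) using (_∈?_)

countInside : ∀ {m n} → Vec Bool m → Bool → List (Vec (Fin m) n) → ℕ
countInside σ s B = length (filter (λ b → VAll.all? (λ a → lookup σ a ≟B s) b) B)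

-- Let X_s(σ) be the number of tuples of B inside part s of the partition σ, and Y_s = 2^n X_s.
-- Over the 2^m partitions, a tuple with distinct components lies in part s for a 2^-n fraction
-- of them, and two tuples without a common component do so independently: toggling a single
-- coordinate is a bijection of the partitions. So Y_s has mean |B| and second moment at most
-- |B|² + 2^n W, where W counts the common components of pairs of tuples of B; if every a lies in
-- at most |B|/K tuples then W ≤ n|B|²/K. By Chebyshev, 2 Y_s < |B| for at most a 4·2^n n/K ≤ 1/4
-- fraction of the partitions when K ≥ 16·2^n n, so at least half of the partitions put at least
-- |B|/2^(n+1) tuples in each part.
module Submission where

open import Defs
open import Data.Bool using (Bool; true; false; _∧_; not)
open import Data.Bool.Properties using () renaming (_≟_ to _≟ᵇ_)
open import Data.Fin using (Fin; zero; suc)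
open import Data.Fin.Properties using (_≟_; suc-injective)
open import Data.List using (List; []; _∷_; _++_; map; length; filter)
open import Data.List.Membership.Propositional using () renaming (_∈_ to _∈ˡ_)
open import Data.List.Properties using (length-++; length-map)
open import Data.List.Relation.Unary.All using (All; []; _∷_)
open import Data.List.Relation.Unary.Any using (here; there)
open import Data.List.Relation.Unary.Unique.Propositional using (Unique)
open import Data.Nat using (ℕ; zero; suc; _+_; _*_; _^_; _≤_; _<_; z≤n; z<s; s≤s; >-nonZero)
open import Data.Nat.Properties hiding (_≟_; suc-injective)
open import Data.Nat.Tactic.RingSolver using (solve-∀)
open import Data.Product using (Σ; _,_)
open import Data.Sum using ([_,_]′)
open import Data.Vec using (Vec; []; _∷_; lookup; toList; updateAt)
open import Data.Vec.Properties using (lookup∘updateAt; lookup∘updateAt′; length-toList)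
open import Data.Vec.Membership.Propositional using (_∈_)
open import Data.Vec.Membership.Propositional.Properties using (∈-lookup; ∈-toList⁺)
import Data.Vec.Membership.DecPropositional as DecMembership
import Data.Vec.Relation.Unary.All as Vec
open import Function using (_∘_)
open import Level using (Level)
open import Relation.Binary.PropositionalEquality
open import Relation.Nullary using (¬_; Dec; yes; no; does; ¬?; contradiction)
open import Relation.Nullary.Decidable using (_×-dec_; dec-true)
open import Relation.Unary using (Pred; Decidable)
open import Algebra.Properties.CommutativeSemigroup +-commutativeSemigroup
  using () renaming (interchange to +-interchange)
open import Algebra.Properties.CommutativeSemigroup *-commutativeSemigroup
  using (x∙yz≈y∙xz)

private variable
  ℓ p q : Level
  A : Set ℓ
  m k k′ : ℕ

-- Sums over lists

𝟙 : Bool → ℕ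
𝟙 true  = 1
𝟙 false = 0

𝟙-∧ : ∀ c d → 𝟙 (c ∧ d) ≡ 𝟙 c * 𝟙 d
𝟙-∧ true  d = sym (+-identityʳ (𝟙 d))
𝟙-∧ false d = refl

𝟙-*-≤ : ∀ c v → 𝟙 c * v ≤ v
𝟙-*-≤ true  v = ≤-reflexive (+-identityʳ v)
𝟙-*-≤ false v = z≤n

∑ : List A → (A → ℕ) → ℕ
∑ []       f = 0
∑ (x ∷ xs) f = f x + ∑ xs f

infixl 10 ∑
syntax ∑ xs (λ x → e) = ∑[ x ← xs ] e

∑-cong : ∀ (xs : List A) {f g : A → ℕ} → f ≗ g → ∑ xs f ≡ ∑ xs g
∑-cong []       f≗g = refl
∑-cong (x ∷ xs) f≗g = cong₂ _+_ (f≗g x) (∑-cong xs f≗g)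

∑-cong-All : ∀ {P : Pred A p} {xs : List A} {f g : A → ℕ} →
  All P xs → (∀ {x} → P x → f x ≡ g x) → ∑ xs f ≡ ∑ xs g
∑-cong-All []         f≡g = refl
∑-cong-All (px ∷ pxs) f≡g = cong₂ _+_ (f≡g px) (∑-cong-All pxs f≡g)

∑-mono : ∀ (xs : List A) {f g : A → ℕ} → (∀ x → f x ≤ g x) → ∑ xs f ≤ ∑ xs g
∑-mono []       f≤g = z≤n
∑-mono (x ∷ xs) f≤g = +-mono-≤ (f≤g x) (∑-mono xs f≤g)

∑-mono-All : ∀ {P : Pred A p} {xs : List A} {f g : A → ℕ} →
  All P xs → (∀ {x} → P x → f x ≤ g x) → ∑ xs f ≤ ∑ xs g
∑-mono-All []         f≤g = z≤n
∑-mono-All (px ∷ pxs) f≤g = +-mono-≤ (f≤g px) (∑-mono-All pxs f≤g)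

∑-+ : ∀ (xs : List A) (f g : A → ℕ) → ∑[ x ← xs ] (f x + g x) ≡ ∑ xs f + ∑ xs g
∑-+ []       f g = refl
∑-+ (x ∷ xs) f g = trans (cong (f x + g x +_) (∑-+ xs f g)) (+-interchange (f x) (g x) (∑ xs f) (∑ xs g))

∑-*ˡ : ∀ (xs : List A) (f : A → ℕ) c → ∑[ x ← xs ] (c * f x) ≡ c * ∑ xs f
∑-*ˡ []       f c = sym (*-zeroʳ c)
∑-*ˡ (x ∷ xs) f c = trans (cong (c * f x +_) (∑-*ˡ xs f c)) (sym (*-distribˡ-+ c (f x) (∑ xs f)))

∑-*ʳ : ∀ (xs : List A) (f : A → ℕ) c → ∑[ x ← xs ] (f x * c) ≡ ∑ xs f * c
∑-*ʳ []       f c = refl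
∑-*ʳ (x ∷ xs) f c = trans (cong (f x * c +_) (∑-*ʳ xs f c)) (sym (*-distribʳ-+ c (f x) (∑ xs f)))

∑-const : ∀ (xs : List A) c → ∑[ _ ← xs ] c ≡ length xs * c
∑-const []       c = refl
∑-const (x ∷ xs) c = cong (c +_) (∑-const xs c)

∑-affine : ∀ (xs : List A) c (f : A → ℕ) d → ∑[ x ← xs ] (c + f x * d) ≡ length xs * c + ∑ xs f * d
∑-affine xs c f d = trans (∑-+ xs _ _) (cong₂ _+_ (∑-const xs c) (∑-*ʳ xs f d))

∑-swap : ∀ {B : Set ℓ} (xs : List A) (ys : List B) (f : A → B → ℕ) →
  ∑[ x ← xs ] ∑[ y ← ys ] f x y ≡ ∑[ y ← ys ] ∑[ x ← xs ] f x y
∑-swap []       ys f = sym (trans (∑-const ys 0) (*-zeroʳ (length ys)))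
∑-swap (x ∷ xs) ys f = trans (cong (∑ ys (f x) +_) (∑-swap xs ys f)) (sym (∑-+ ys (f x) _))

∑-*-∑ : ∀ {B : Set ℓ} (xs : List A) (ys : List B) (f : A → ℕ) (g : B → ℕ) →
  ∑ xs f * ∑ ys g ≡ ∑[ x ← xs ] ∑[ y ← ys ] (f x * g y)
∑-*-∑ xs ys f g =
  trans (sym (∑-*ʳ xs f (∑ ys g))) (∑-cong xs (λ x → sym (∑-*ˡ ys g (f x))))

∑-++ : ∀ (xs ys : List A) (f : A → ℕ) → ∑ (xs ++ ys) f ≡ ∑ xs f + ∑ ys f
∑-++ []       ys f = refl
∑-++ (x ∷ xs) ys f = trans (cong (f x +_) (∑-++ xs ys f)) (sym (+-assoc (f x) _ _))

∑-map : ∀ {B : Set ℓ} (h : A → B) (xs : List A) (f : B → ℕ) → ∑ (map h xs) f ≡ ∑[ x ← xs ] f (h x)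
∑-map h []       f = refl
∑-map h (x ∷ xs) f = cong (f (h x) +_) (∑-map h xs f)

∈⇒≤∑ : ∀ {xs : List A} {x} (f : A → ℕ) → x ∈ˡ xs → f x ≤ ∑ xs f
∈⇒≤∑ f (here refl)  = m≤m+n _ _
∈⇒≤∑ f (there x∈xs) = ≤-trans (∈⇒≤∑ f x∈xs) (m≤n+m _ _)

length-filter≡∑ : ∀ {P : Pred A p} (P? : Decidable P) (xs : List A) →
  length (filter P? xs) ≡ ∑[ x ← xs ] 𝟙 (does (P? x))
length-filter≡∑ P? []       = refl
length-filter≡∑ P? (x ∷ xs) with does (P? x)
... | true  = cong suc (length-filter≡∑ P? xs)
... | false = length-filter≡∑ P? xs

length-filter-×-dec : ∀ {P : Pred A p} {Q : Pred A q} (P? : Decidable P) (Q? : Decidable Q) (xs : List A) →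
  length xs ≤ length (filter (λ x → P? x ×-dec Q? x) xs) + length (filter (¬? ∘ P?) xs) + length (filter (¬? ∘ Q?) xs)
length-filter-×-dec {A = A} P? Q? xs = begin
  length xs                              ≡⟨ sym (trans (∑-const xs 1) (*-identityʳ _)) ⟩
  ∑[ x ← xs ] 1                          ≤⟨ ∑-mono xs (λ x → covered (does (P? x)) (does (Q? x))) ⟩
  ∑[ x ← xs ] (both x + notP x + notQ x) ≡⟨ ∑-+ xs (λ x → both x + notP x) notQ ⟩
  ∑[ x ← xs ] (both x + notP x) + ∑ xs notQ
    ≡⟨ cong (_+ ∑ xs notQ) (∑-+ xs both notP) ⟩
  ∑ xs both + ∑ xs notP + ∑ xs notQ
    ≡⟨ sym (cong₂ _+_ (cong₂ _+_ (length-filter≡∑ _ xs) (length-filter≡∑ _ xs)) (length-filter≡∑ _ xs)) ⟩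
  _ ∎
  where
  open ≤-Reasoning
  both notP notQ : A → ℕ
  both x = 𝟙 (does (P? x ×-dec Q? x))
  notP x = 𝟙 (does (¬? (P? x)))
  notQ x = 𝟙 (does (¬? (Q? x)))
  covered : ∀ c d → 1 ≤ 𝟙 (c ∧ d) + 𝟙 (not c) + 𝟙 (not d)
  covered true  true  = ≤-refl
  covered true  false = ≤-refl
  covered false d     = m≤m+n 1 _

both-hold-on-half : ∀ {P : Pred A p} {Q : Pred A q} (P? : Decidable P) (Q? : Decidable Q) (xs : List A) {N} →
  length xs ≡ N → 4 * length (filter (¬? ∘ P?) xs) ≤ N → 4 * length (filter (¬? ∘ Q?) xs) ≤ N →
  N ≤ 2 * length (filter (λ x → P? x ×-dec Q? x) xs)
both-hold-on-half P? Q? xs refl P-rare Q-rare =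
  *-cancelˡ-≤ 2 (+-cancelʳ-≤ (2 * N) (2 * N) (2 * (2 * G)) (begin
    2 * N + 2 * N           ≡⟨ double N ⟩
    4 * N                   ≤⟨ *-monoʳ-≤ 4 (length-filter-×-dec P? Q? xs) ⟩
    4 * (G + a + c)         ≡⟨ spread G a c ⟩
    4 * G + (4 * a + 4 * c) ≤⟨ +-monoʳ-≤ (4 * G) (+-mono-≤ P-rare Q-rare) ⟩
    4 * G + (N + N)         ≡⟨ gather G N ⟩
    2 * (2 * G) + 2 * N     ∎))
  where
  open ≤-Reasoning
  N G a c : ℕ
  N = length xs
  G = length (filter (λ x → P? x ×-dec Q? x) xs)
  a = length (filter (¬? ∘ P?) xs)
  c = length (filter (¬? ∘ Q?) xs)
  double : ∀ N → 2 * N + 2 * N ≡ 4 * N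
  double = solve-∀
  spread : ∀ G a c → 4 * (G + a + c) ≡ 4 * G + (4 * a + 4 * c)
  spread = solve-∀
  gather : ∀ G N → 4 * G + (N + N) ≡ 2 * (2 * G) + 2 * N
  gather = solve-∀

≢[]⇒length>0 : ∀ {xs : List A} → xs ≢ [] → 0 < length xs
≢[]⇒length>0 {xs = []}    xs≢[] = contradiction refl xs≢[]
≢[]⇒length>0 {xs = _ ∷ _} _     = z<s

-- The second-moment method

2*[m*n]≤m*m+n*n : ∀ a b → 2 * (a * b) ≤ a * a + b * b
2*[m*n]≤m*m+n*n a b = [ ordered , flipped ]′ (≤-total a b)
  where
  ordered : ∀ {a b} → a ≤ b → 2 * (a * b) ≤ a * a + b * b
  ordered {a} a≤b with d , refl ← m≤n⇒∃[o]m+o≡n a≤b = subst (2 * (a * (a + d)) ≤_) (square a d) (m≤m+n _ (d * d))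
    where
    square : ∀ a d → 2 * (a * (a + d)) + d * d ≡ a * a + (a + d) * (a + d)
    square = solve-∀
  flipped : b ≤ a → 2 * (a * b) ≤ a * a + b * b
  flipped b≤a = subst₂ _≤_ (cong (2 *_) (*-comm b a)) (+-comm (b * b) (a * a)) (ordered b≤a)

-- 𝟙[S] L² ≤ 4 (L - y)², with the square expanded so that no subtraction occurs.
chebyshev-pointwise : ∀ {S : Set p} (S? : Dec S) L y → (S → 2 * y ≤ L) →
  𝟙 (does S?) * (L * L) + 8 * L * y ≤ 4 * (L * L) + 4 * (y * y)
chebyshev-pointwise (no _) L y _ = begin
  8 * L * y              ≡⟨ regroup L y ⟩
  4 * (2 * (L * y))      ≤⟨ *-monoʳ-≤ 4 (2*[m*n]≤m*m+n*n L y) ⟩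
  4 * (L * L + y * y)    ≡⟨ *-distribˡ-+ 4 (L * L) (y * y) ⟩
  4 * (L * L) + 4 * (y * y) ∎
  where
  open ≤-Reasoning
  regroup : ∀ L y → 8 * L * y ≡ 4 * (2 * (L * y))
  regroup = solve-∀
chebyshev-pointwise (yes s) L y small with e , refl ← m≤n⇒∃[o]m+o≡n (small s) =
  subst (𝟙 true * (L * L) + 8 * L * y ≤_) (slack y e) (m≤m+n _ (4 * y * e + 3 * (e * e)))
  where
  slack : ∀ y e → let L = 2 * y + e in
    1 * (L * L) + 8 * L * y + (4 * y * e + 3 * (e * e)) ≡ 4 * (L * L) + 4 * (y * y)
  slack = solve-∀

chebyshev-lower-tail : ∀ (xs : List A) {N} → length xs ≡ N → (Y : A → ℕ) (L V : ℕ) {S : Pred A p} (S? : Decidable S) →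
  (∀ {x} → S x → 2 * Y x ≤ L) →
  ∑ xs Y ≡ L * N →
  ∑[ x ← xs ] (Y x * Y x) ≤ L * L * N + V →
  length (filter S? xs) * (L * L) ≤ 4 * V
chebyshev-lower-tail {A = A} xs refl Y L V S? small mean second = +-cancelˡ-≤ (8 * (L * L * N)) _ _ (begin
  8 * (L * L * N) + length (filter S? xs) * (L * L)
    ≡⟨ +-comm (8 * (L * L * N)) _ ⟩
  length (filter S? xs) * (L * L) + 8 * (L * L * N)
    ≡⟨ cong₂ _+_ (cong (_* (L * L)) (length-filter≡∑ S? xs)) (trans (regroup L N) (cong (8 * L *_) (sym mean))) ⟩
  ∑ xs indicator * (L * L) + 8 * L * ∑ xs Y
    ≡⟨ sym (cong₂ _+_ (∑-*ʳ xs indicator (L * L)) (∑-*ˡ xs Y (8 * L))) ⟩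
  ∑[ x ← xs ] (indicator x * (L * L)) + ∑[ x ← xs ] (8 * L * Y x)
    ≡⟨ sym (∑-+ xs _ _) ⟩
  ∑[ x ← xs ] (indicator x * (L * L) + 8 * L * Y x)
    ≤⟨ ∑-mono xs (λ x → chebyshev-pointwise (S? x) L (Y x) small) ⟩
  ∑[ x ← xs ] (4 * (L * L) + 4 * (Y x * Y x))
    ≡⟨ trans (∑-+ xs _ _) (cong₂ _+_ (∑-const xs _) (∑-*ˡ xs (λ x → Y x * Y x) 4)) ⟩
  N * (4 * (L * L)) + 4 * ∑[ x ← xs ] (Y x * Y x)
    ≤⟨ +-monoʳ-≤ (N * (4 * (L * L))) (*-monoʳ-≤ 4 second) ⟩
  N * (4 * (L * L)) + 4 * (L * L * N + V)
    ≡⟨ collect L N V ⟩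
  8 * (L * L * N) + 4 * V ∎)
  where
  open ≤-Reasoning
  N : ℕ
  N = length xs
  indicator : A → ℕ
  indicator x = 𝟙 (does (S? x))
  regroup : ∀ L N → 8 * (L * L * N) ≡ 8 * L * (L * N)
  regroup = solve-∀
  collect : ∀ L N V → N * (4 * (L * L)) + 4 * (L * L * N + V) ≡ 8 * (L * L * N) + 4 * V
  collect = solve-∀

-- Uniformly random partitions

length-allPartitions : ∀ m → length (allPartitions m) ≡ 2 ^ m
length-allPartitions zero    = refl
length-allPartitions (suc m) = begin
  length (map (true ∷_) P ++ map (false ∷_) P)         ≡⟨ length-++ (map (true ∷_) P) ⟩
  length (map (true ∷_) P) + length (map (false ∷_) P) ≡⟨ cong₂ _+_ (length-map _ P) (length-map _ P) ⟩
  length P + length P                                   ≡⟨ cong (λ l → l + l) (length-allPartitions m) ⟩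
  2 ^ m + 2 ^ m                                         ≡⟨ cong (2 ^ m +_) (sym (+-identityʳ (2 ^ m))) ⟩
  2 ^ suc m                                             ∎
  where
  open ≡-Reasoning
  P : List (Vec Bool m)
  P = allPartitions m

∑-allPartitions-const : ∀ m c → ∑[ _ ← allPartitions m ] c ≡ 2 ^ m * c
∑-allPartitions-const m c = trans (∑-const (allPartitions m) c) (cong (_* c) (length-allPartitions m))

∑-allPartitions-suc : ∀ m (f : Vec Bool (suc m) → ℕ) →
  ∑ (allPartitions (suc m)) f ≡ ∑[ σ ← allPartitions m ] f (true ∷ σ) + ∑[ σ ← allPartitions m ] f (false ∷ σ)
∑-allPartitions-suc m f = trans (∑-++ (map (true ∷_) P) (map (false ∷_) P) f) (cong₂ _+_ (∑-map _ P f) (∑-map _ P f))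
  where
  P : List (Vec Bool m)
  P = allPartitions m

toggle : Fin m → Vec Bool m → Vec Bool m
toggle x σ = updateAt σ x not

ToggleInvariant : Fin m → (Vec Bool m → ℕ) → Set
ToggleInvariant x f = ∀ σ → f (toggle x σ) ≡ f σ

∑-toggle : ∀ (x : Fin m) (f : Vec Bool m → ℕ) → ∑[ σ ← allPartitions m ] f (toggle x σ) ≡ ∑ (allPartitions m) f
∑-toggle {suc m} zero f = begin
  ∑[ σ ← allPartitions (suc m) ] f (toggle zero σ)                   ≡⟨ ∑-allPartitions-suc m (f ∘ toggle zero) ⟩
  ∑[ σ ← P ] f (false ∷ σ) + ∑[ σ ← P ] f (true ∷ σ)                 ≡⟨ +-comm (∑[ σ ← P ] f (false ∷ σ)) _ ⟩
  ∑[ σ ← P ] f (true ∷ σ) + ∑[ σ ← P ] f (false ∷ σ)                 ≡⟨ sym (∑-allPartitions-suc m f) ⟩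
  ∑ (allPartitions (suc m)) f                                        ∎
  where
  open ≡-Reasoning
  P : List (Vec Bool m)
  P = allPartitions m
∑-toggle {suc m} (suc x) f = begin
  ∑[ σ ← allPartitions (suc m) ] f (toggle (suc x) σ)                ≡⟨ ∑-allPartitions-suc m (f ∘ toggle (suc x)) ⟩
  ∑[ σ ← P ] f (true ∷ toggle x σ) + ∑[ σ ← P ] f (false ∷ toggle x σ)
    ≡⟨ cong₂ _+_ (∑-toggle x (f ∘ (true ∷_))) (∑-toggle x (f ∘ (false ∷_))) ⟩
  ∑[ σ ← P ] f (true ∷ σ) + ∑[ σ ← P ] f (false ∷ σ)                 ≡⟨ sym (∑-allPartitions-suc m f) ⟩
  ∑ (allPartitions (suc m)) f                                        ∎
  where
  open ≡-Reasoning
  P : List (Vec Bool m)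
  P = allPartitions m

onSideAt : Vec Bool m → Bool → Fin m → Bool
onSideAt σ s x = does (lookup σ x ≟ᵇ s)

𝟙-onSideAt-toggle : ∀ (σ : Vec Bool m) s x → 𝟙 (onSideAt σ s x) + 𝟙 (onSideAt (toggle x σ) s x) ≡ 1
𝟙-onSideAt-toggle σ s x rewrite lookup∘updateAt x {not} σ = sides (lookup σ x) s
  where
  sides : ∀ c s → 𝟙 (does (c ≟ᵇ s)) + 𝟙 (does (not c ≟ᵇ s)) ≡ 1
  sides false false = refl
  sides false true  = refl
  sides true  false = refl
  sides true  true  = refl

∑-half : ∀ (x : Fin m) s (g : Vec Bool m → ℕ) → ToggleInvariant x g →
  2 * ∑[ σ ← allPartitions m ] (𝟙 (onSideAt σ s x) * g σ) ≡ ∑ (allPartitions m) g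
∑-half {m} x s g g-inv = begin
  2 * ∑ P h                           ≡⟨ cong (∑ P h +_) (+-identityʳ (∑ P h)) ⟩
  ∑ P h + ∑ P h                       ≡⟨ cong (∑ P h +_) (sym (∑-toggle x h)) ⟩
  ∑ P h + ∑[ σ ← P ] h (toggle x σ)   ≡⟨ sym (∑-+ P h (h ∘ toggle x)) ⟩
  ∑[ σ ← P ] (h σ + h (toggle x σ))   ≡⟨ ∑-cong P split ⟩
  ∑ P g                               ∎
  where
  open ≡-Reasoning
  P : List (Vec Bool m)
  P = allPartitions m
  h : Vec Bool m → ℕ
  h σ = 𝟙 (onSideAt σ s x) * g σ
  split : ∀ σ → h σ + h (toggle x σ) ≡ g σ
  split σ = begin
    𝟙 (onSideAt σ s x) * g σ + 𝟙 (onSideAt (toggle x σ) s x) * g (toggle x σ)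
      ≡⟨ cong (λ v → 𝟙 (onSideAt σ s x) * g σ + 𝟙 (onSideAt (toggle x σ) s x) * v) (g-inv σ) ⟩
    𝟙 (onSideAt σ s x) * g σ + 𝟙 (onSideAt (toggle x σ) s x) * g σ
      ≡⟨ sym (*-distribʳ-+ (g σ) (𝟙 (onSideAt σ s x)) _) ⟩
    (𝟙 (onSideAt σ s x) + 𝟙 (onSideAt (toggle x σ) s x)) * g σ
      ≡⟨ cong (_* g σ) (𝟙-onSideAt-toggle σ s x) ⟩
    1 * g σ
      ≡⟨ *-identityˡ (g σ) ⟩
    g σ ∎

onSide : Vec Bool m → Bool → Vec (Fin m) k → Bool
onSide σ s b = does (Vec.all? (λ a → lookup σ a ≟ᵇ s) b)

onSide-toggle : ∀ s (b : Vec (Fin m) k) {y} → (∀ i → lookup b i ≢ y) →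
  ∀ σ → onSide (toggle y σ) s b ≡ onSide σ s b
onSide-toggle s []      y∉b σ = refl
onSide-toggle s (x ∷ b) y∉b σ =
  cong₂ _∧_ (cong (λ c → does (c ≟ᵇ s)) (lookup∘updateAt′ x _ (y∉b zero) σ)) (onSide-toggle s b (y∉b ∘ suc) σ)

∑-onSide : ∀ s (b : Vec (Fin m) k) → DistinctTuple b → (f : Vec Bool m → ℕ) → (∀ i → ToggleInvariant (lookup b i) f) →
  ∑[ σ ← allPartitions m ] (𝟙 (onSide σ s b) * 2 ^ k * f σ) ≡ ∑ (allPartitions m) f
∑-onSide s [] _ f _ = ∑-cong (allPartitions _) (λ σ → +-identityʳ (f σ))
∑-onSide {m} {suc k} s (x ∷ b) distinct f f-inv = begin
  ∑[ σ ← P ] (𝟙 (onSide σ s (x ∷ b)) * 2 ^ suc k * f σ)  ≡⟨ ∑-cong P regroup ⟩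
  ∑[ σ ← P ] (2 * (𝟙 (onSideAt σ s x) * g σ))            ≡⟨ ∑-*ˡ P _ 2 ⟩
  2 * ∑[ σ ← P ] (𝟙 (onSideAt σ s x) * g σ)              ≡⟨ ∑-half x s g g-inv ⟩
  ∑ P g                                                  ≡⟨ ∑-onSide s b (λ i j → suc-injective ∘ distinct (suc i) (suc j)) f (f-inv ∘ suc) ⟩
  ∑ P f                                                  ∎
  where
  open ≡-Reasoning
  P : List (Vec Bool m)
  P = allPartitions m
  g : Vec Bool m → ℕ
  g σ = 𝟙 (onSide σ s b) * 2 ^ k * f σ
  x∉b : ∀ i → lookup b i ≢ x
  x∉b i bᵢ≡x with () ← distinct zero (suc i) (sym bᵢ≡x)
  g-inv : ToggleInvariant x g
  g-inv σ = cong₂ (λ c v → 𝟙 c * 2 ^ k * v) (onSide-toggle s b x∉b σ) (f-inv zero σ)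
  regroup : ∀ σ → 𝟙 (onSide σ s (x ∷ b)) * 2 ^ suc k * f σ ≡ 2 * (𝟙 (onSideAt σ s x) * g σ)
  regroup σ = trans (cong (λ v → v * 2 ^ suc k * f σ) (𝟙-∧ (onSideAt σ s x) (onSide σ s b)))
                    (shuffle (𝟙 (onSideAt σ s x)) (𝟙 (onSide σ s b)) (2 ^ k) (f σ))
    where
    shuffle : ∀ c d e v → c * d * (2 * e) * v ≡ 2 * (c * (d * e * v))
    shuffle = solve-∀

∑-onSide-count : ∀ s (b : Vec (Fin m) k) → DistinctTuple b → ∑[ σ ← allPartitions m ] (𝟙 (onSide σ s b) * 2 ^ k) ≡ 2 ^ m
∑-onSide-count {m} {k} s b distinct = begin
  ∑[ σ ← P ] (𝟙 (onSide σ s b) * 2 ^ k)      ≡⟨ ∑-cong P (λ σ → sym (*-identityʳ _)) ⟩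
  ∑[ σ ← P ] (𝟙 (onSide σ s b) * 2 ^ k * 1)  ≡⟨ ∑-onSide s b distinct (λ _ → 1) (λ _ _ → refl) ⟩
  ∑[ _ ← P ] 1                               ≡⟨ ∑-allPartitions-const m 1 ⟩
  2 ^ m * 1                                  ≡⟨ *-identityʳ (2 ^ m) ⟩
  2 ^ m                                      ∎
  where
  open ≡-Reasoning
  P : List (Vec Bool m)
  P = allPartitions m

_∈?_ : (x : Fin m) (b : Vec (Fin m) k) → Dec (x ∈ b)
x ∈? b = DecMembership._∈?_ _≟_ x b

shared : Vec (Fin m) k → Vec (Fin m) k′ → ℕ
shared b b′ = ∑[ x ← toList b ] 𝟙 (does (x ∈? b′))

shared≡0⇒disjoint : ∀ (b : Vec (Fin m) k) (b′ : Vec (Fin m) k′) → shared b b′ ≡ 0 →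
  ∀ j i → lookup b′ i ≢ lookup b j
shared≡0⇒disjoint b b′ shared≡0 j i b′ᵢ≡bⱼ = contradiction 1≤0 λ ()
  where
  open ≤-Reasoning
  bⱼ∈b′ : lookup b j ∈ b′
  bⱼ∈b′ = subst (_∈ b′) b′ᵢ≡bⱼ (∈-lookup i b′)
  1≤0 : 1 ≤ 0
  1≤0 = begin
    1                                           ≡⟨ cong 𝟙 (sym (dec-true (lookup b j ∈? b′) bⱼ∈b′)) ⟩
    𝟙 (does (lookup b j ∈? b′))                 ≤⟨ ∈⇒≤∑ (λ x → 𝟙 (does (x ∈? b′))) (∈-toList⁺ (∈-lookup j b)) ⟩
    shared b b′                                 ≡⟨ shared≡0 ⟩
    0                                           ∎

∑-onSide-pair : ∀ s (b : Vec (Fin m) k) (b′ : Vec (Fin m) k′) → DistinctTuple b → DistinctTuple b′ →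
  ∑[ σ ← allPartitions m ] (𝟙 (onSide σ s b) * 2 ^ k * (𝟙 (onSide σ s b′) * 2 ^ k′))
    ≤ 2 ^ m + shared b b′ * (2 ^ m * 2 ^ k′)
∑-onSide-pair {m} {k} {k′} s b b′ d d′ with shared b b′ in shared≡
... | zero = begin
  ∑[ σ ← P ] (𝟙 (onSide σ s b) * 2 ^ k * (𝟙 (onSide σ s b′) * 2 ^ k′)) ≡⟨ ∑-onSide s b d _ independent ⟩
  ∑[ σ ← P ] (𝟙 (onSide σ s b′) * 2 ^ k′)                               ≡⟨ ∑-onSide-count s b′ d′ ⟩
  2 ^ m                                                                ≤⟨ m≤m+n (2 ^ m) 0 ⟩
  2 ^ m + 0                                                            ∎
  where
  open ≤-Reasoning
  P : List (Vec Bool m)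
  P = allPartitions m
  independent : ∀ j → ToggleInvariant (lookup b j) (λ σ → 𝟙 (onSide σ s b′) * 2 ^ k′)
  independent j σ = cong (λ c → 𝟙 c * 2 ^ k′) (onSide-toggle s b′ (shared≡0⇒disjoint b b′ shared≡ j) σ)
... | suc o = begin
  ∑[ σ ← P ] (𝟙 (onSide σ s b) * 2 ^ k * (𝟙 (onSide σ s b′) * 2 ^ k′))
    ≤⟨ ∑-mono P (λ σ → *-monoʳ-≤ (𝟙 (onSide σ s b) * 2 ^ k) (𝟙-*-≤ (onSide σ s b′) (2 ^ k′))) ⟩
  ∑[ σ ← P ] (𝟙 (onSide σ s b) * 2 ^ k * 2 ^ k′) ≡⟨ ∑-onSide s b d (λ _ → 2 ^ k′) (λ _ _ → refl) ⟩
  ∑[ _ ← P ] (2 ^ k′)                            ≡⟨ ∑-allPartitions-const m (2 ^ k′) ⟩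
  2 ^ m * 2 ^ k′                                 ≤⟨ m≤m+n (2 ^ m * 2 ^ k′) (o * (2 ^ m * 2 ^ k′)) ⟩
  suc o * (2 ^ m * 2 ^ k′)                       ≤⟨ m≤n+m _ (2 ^ m) ⟩
  2 ^ m + suc o * (2 ^ m * 2 ^ k′)               ∎
  where
  open ≤-Reasoning
  P : List (Vec Bool m)
  P = allPartitions m

-- Balanced partitions

module _ {m n : ℕ} (B : List (Vec (Fin m) n)) where

  scaledCount : Bool → Vec Bool m → ℕ
  scaledCount s σ = countInside σ s B * 2 ^ n

  scaledCount≡∑ : ∀ s σ → scaledCount s σ ≡ ∑[ b ← B ] (𝟙 (onSide σ s b) * 2 ^ n)
  scaledCount≡∑ s σ = trans (cong (_* 2 ^ n) (length-filter≡∑ _ B)) (sym (∑-*ʳ B _ (2 ^ n)))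

  ∑-scaledCount : All DistinctTuple B → ∀ s → ∑ (allPartitions m) (scaledCount s) ≡ length B * 2 ^ m
  ∑-scaledCount distinct s = begin
    ∑ P (scaledCount s)                               ≡⟨ ∑-cong P (scaledCount≡∑ s) ⟩
    ∑[ σ ← P ] ∑[ b ← B ] (𝟙 (onSide σ s b) * 2 ^ n) ≡⟨ ∑-swap P B _ ⟩
    ∑[ b ← B ] ∑[ σ ← P ] (𝟙 (onSide σ s b) * 2 ^ n) ≡⟨ ∑-cong-All distinct (λ {b} → ∑-onSide-count s b) ⟩
    ∑[ _ ← B ] (2 ^ m)                                ≡⟨ ∑-const B (2 ^ m) ⟩
    length B * 2 ^ m                                  ∎
    where
    open ≡-Reasoning
    P : List (Vec Bool m)
    P = allPartitions m

  totalShared : ℕ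
  totalShared = ∑[ b ← B ] ∑[ b′ ← B ] shared b b′

  ∑-scaledCount² : All DistinctTuple B → ∀ s →
    ∑[ σ ← allPartitions m ] (scaledCount s σ * scaledCount s σ) ≤ length B * length B * 2 ^ m + totalShared * (2 ^ m * 2 ^ n)
  ∑-scaledCount² distinct s = begin
    ∑[ σ ← P ] (scaledCount s σ * scaledCount s σ)
      ≡⟨ ∑-cong P (λ σ → trans (cong₂ _*_ (scaledCount≡∑ s σ) (scaledCount≡∑ s σ)) (∑-*-∑ B B _ _)) ⟩
    ∑[ σ ← P ] ∑[ b ← B ] ∑[ b′ ← B ] pair σ b b′
      ≡⟨ trans (∑-swap P B _) (∑-cong B (λ b → ∑-swap P B _)) ⟩
    ∑[ b ← B ] ∑[ b′ ← B ] ∑[ σ ← P ] pair σ b b′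
      ≤⟨ ∑-mono-All distinct (λ {b} d → ∑-mono-All distinct (λ {b′} d′ → ∑-onSide-pair s b b′ d d′)) ⟩
    ∑[ b ← B ] ∑[ b′ ← B ] (2 ^ m + shared b b′ * (2 ^ m * 2 ^ n))
      ≡⟨ ∑-cong B (λ b → ∑-affine B (2 ^ m) (shared b) _) ⟩
    ∑[ b ← B ] (length B * 2 ^ m + (∑[ b′ ← B ] shared b b′) * (2 ^ m * 2 ^ n))
      ≡⟨ ∑-affine B (length B * 2 ^ m) _ _ ⟩
    length B * (length B * 2 ^ m) + totalShared * (2 ^ m * 2 ^ n)
      ≡⟨ cong (_+ totalShared * (2 ^ m * 2 ^ n)) (sym (*-assoc (length B) (length B) (2 ^ m))) ⟩
    length B * length B * 2 ^ m + totalShared * (2 ^ m * 2 ^ n) ∎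
    where
    open ≤-Reasoning
    P : List (Vec Bool m)
    P = allPartitions m
    pair : Vec Bool m → Vec (Fin m) n → Vec (Fin m) n → ℕ
    pair σ b b′ = 𝟙 (onSide σ s b) * 2 ^ n * (𝟙 (onSide σ s b′) * 2 ^ n)

  totalShared-bound : ∀ K → (∀ a → countContaining a B * K ≤ length B) → totalShared * K ≤ length B * length B * n
  totalShared-bound K sparse = begin
    totalShared * K                            ≡⟨ sym (∑-*ʳ B _ K) ⟩
    ∑[ b ← B ] ((∑[ b′ ← B ] shared b b′) * K) ≤⟨ ∑-mono B row-bound ⟩
    ∑[ _ ← B ] (n * length B)                  ≡⟨ ∑-const B _ ⟩
    length B * (n * length B)                  ≡⟨ regroup (length B) n ⟩
    length B * length B * n                    ∎
    where
    open ≤-Reasoning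
    regroup : ∀ L n → L * (n * L) ≡ L * L * n
    regroup = solve-∀
    row-bound : ∀ b → (∑[ b′ ← B ] shared b b′) * K ≤ n * length B
    row-bound b = begin
      (∑[ b′ ← B ] shared b b′) * K                                ≡⟨ cong (_* K) (∑-swap B (toList b) _) ⟩
      (∑[ x ← toList b ] ∑[ b′ ← B ] 𝟙 (does (x ∈? b′))) * K       ≡⟨ cong (_* K) (∑-cong (toList b) (λ x → sym (length-filter≡∑ (x ∈?_) B))) ⟩
      (∑[ x ← toList b ] countContaining x B) * K                  ≡⟨ sym (∑-*ʳ (toList b) _ K) ⟩
      ∑[ x ← toList b ] (countContaining x B * K)                  ≤⟨ ∑-mono (toList b) sparse ⟩
      ∑[ _ ← toList b ] length B                                   ≡⟨ ∑-const (toList b) _ ⟩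
      length (toList b) * length B                                 ≡⟨ cong (_* length B) (length-toList b) ⟩
      n * length B                                                 ∎

  balanced? : ∀ s σ → Dec (length B ≤ countInside σ s B * 2 ^ (2 * n + 1))
  balanced? s σ = length B ≤? countInside σ s B * 2 ^ (2 * n + 1)

  unbalanced⇒small : ∀ {s σ} → ¬ (length B ≤ countInside σ s B * 2 ^ (2 * n + 1)) → 2 * scaledCount s σ ≤ length B
  unbalanced⇒small {s} {σ} unbalanced = begin
    2 * (countInside σ s B * 2 ^ n)         ≡⟨ x∙yz≈y∙xz 2 (countInside σ s B) (2 ^ n) ⟩
    countInside σ s B * 2 ^ suc n           ≤⟨ *-monoʳ-≤ (countInside σ s B) (^-monoʳ-≤ 2 suc-n≤2n+1) ⟩
    countInside σ s B * 2 ^ (2 * n + 1)     ≤⟨ <⇒≤ (≰⇒> unbalanced) ⟩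
    length B                                ∎
    where
    open ≤-Reasoning
    suc-n≤2n+1 : suc n ≤ 2 * n + 1
    suc-n≤2n+1 = subst (suc n ≤_) (+-comm 1 (2 * n)) (s≤s (m≤m+n n (n + 0)))

  unbalanced-rare : All DistinctTuple B → ∀ K → (∀ a → countContaining a B * K ≤ length B) → 16 * 2 ^ n * n ≤ K →
    0 < length B → 0 < n → ∀ s → 4 * length (filter (¬? ∘ balanced? s) (allPartitions m)) ≤ 2 ^ m
  unbalanced-rare distinct K sparse K-large L>0 n>0 s =
    *-cancelʳ-≤ (4 * count) (2 ^ m) (4 * E * n * (L * L)) {{>-nonZero positive}} (begin
      4 * count * (4 * E * n * (L * L))          ≡⟨ regroup₁ count E n (L * L) ⟩
      count * (L * L) * (16 * E * n)             ≤⟨ *-monoʳ-≤ (count * (L * L)) K-large ⟩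
      count * (L * L) * K                        ≤⟨ *-monoˡ-≤ K tail ⟩
      4 * (totalShared * (2 ^ m * E)) * K        ≡⟨ regroup₂ totalShared (2 ^ m) E K ⟩
      4 * 2 ^ m * E * (totalShared * K)          ≤⟨ *-monoʳ-≤ (4 * 2 ^ m * E) (totalShared-bound K sparse) ⟩
      4 * 2 ^ m * E * (L * L * n)                ≡⟨ regroup₃ (2 ^ m) E n (L * L) ⟩
      2 ^ m * (4 * E * n * (L * L))              ∎)
    where
    open ≤-Reasoning
    L E count : ℕ
    L = length B
    E = 2 ^ n
    count = length (filter (¬? ∘ balanced? s) (allPartitions m))
    tail : count * (L * L) ≤ 4 * (totalShared * (2 ^ m * E))
    tail = chebyshev-lower-tail (allPartitions m) (length-allPartitions m) (scaledCount s) L _ (¬? ∘ balanced? s)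
             (λ {σ} → unbalanced⇒small {s} {σ}) (∑-scaledCount distinct s) (∑-scaledCount² distinct s)
    positive : 0 < 4 * E * n * (L * L)
    positive = *-mono-< (*-mono-< (*-mono-< {0} {4} z<s (m^n>0 2 n)) n>0) (*-mono-< L>0 L>0)
    regroup₁ : ∀ c E n M → 4 * c * (4 * E * n * M) ≡ c * M * (16 * E * n)
    regroup₁ = solve-∀
    regroup₂ : ∀ W N E K → 4 * (W * (N * E)) * K ≡ 4 * N * E * (W * K)
    regroup₂ = solve-∀
    regroup₃ : ∀ N E n M → 4 * N * E * (M * n) ≡ N * (4 * E * n * M)
    regroup₃ = solve-∀

lemma9 : (n : ℕ) → 1 ≤ n →
    Σ ℕ λ p → Σ ℕ λ q →
      (m : ℕ) (B : List (Vec (Fin m) n)) →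
      Unique B → B ≢ [] → All DistinctTuple B →
      (∀ (a : Fin m) → countContaining a B * suc q ≤ length B) →
      2 ^ m ≤ suc p * length (filter (λ σ →
          length B ≤? countInside σ true B * 2 ^ (2 * n + 1)
        ×-dec length B ≤? countInside σ false B * 2 ^ (2 * n + 1))
        (allPartitions m))
-- Tuples are counted with multiplicity throughout.
lemma9 n n≥1 = 1 , 16 * 2 ^ n * n , λ m B _ B≢[] distinct sparse →
  let rare = unbalanced-rare B distinct _ sparse (n≤1+n _) (≢[]⇒length>0 B≢[]) n≥1
  in both-hold-on-half (balanced? B true) (balanced? B false) (allPartitions m) (length-allPartitions m) (rare true) (rare false)
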